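{- Let $S$ be a finite linearly ordered set and $T=\{t_1<\dots<t_r\}\subseteq S$. Then the independent sets of the freedom matroid $M_T(S)$ are exactly the sets $A\subseteq S$ with $A\ge T$ in $\mathcal{P}(S)$, and its bases are exactly the sets $B$ with $B\ge T$ in $\mathcal{P}_r(S)$.
   Context: $M_T(S)$ is the matroid on $S$ whose independent sets are the $I$ with $|I\cap T_i|\le i$ for $0\le i\le r$, where $T_r=S$ and $T_i=\{s\in S: s<t_{i+1}\}$ for $0\le i\le r-1$. $\mathcal{P}(S)$ is the set of subsets of $S$ and $\mathcal{P}_r(S)$ the set of $r$-element subsets. For $A=\{a_1<\dots<a_k\}$ and $B=\{b_1<\dots<b_m\}$, set $A\le B$ in $\mathcal{P}(S)$ iff $m\le k$ and $a_i\le b_i$ for $1\le i\le m$; $\mathcal{P}_r(S)$ carries the restriction of this order (componentwise comparison of sorted elements). -}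

module Defs where

open import Data.Nat as ℕ using (ℕ; _≤_)
open import Data.Nat.Properties using () renaming (_<?_ to _<ℕ?_)
open import Data.Fin as Fin using (Fin; toℕ; fromℕ<)
open import Data.Fin.Properties using (_<?_)
open import Data.List using (List; []; _∷_; length; filter; lookup)
open import Data.List.Relation.Unary.Linked using (Linked)
open import Data.List.Relation.Binary.Subset.Propositional using (_⊆_)
open import Data.Product using (_×_)
open import Data.Unit using (⊤)
open import Data.Empty using (⊥)
open import Relation.Nullary using (yes; no)

-- The finite linearly ordered set S is modelled as Fin n with its natural order.
-- A subset of S is represented by the (unique) strictly increasing list of its
-- elements  a₁ < … < aₖ.
Sorted : ∀ {n} → List (Fin n) → Set
Sorted = Linked Fin._<_

-- |I ∩ T_i| for 0 ≤ i ≤ r, where T = t₁ < … < t_r,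
-- T_i = { s ∈ S : s < t_{i+1} } for i < r and T_r = S.
-- (lookup T j, with j 0-indexed, is t_{j+1}.)
∣_∩T[_]_∣ : ∀ {n} → List (Fin n) → (T : List (Fin n)) → Fin (ℕ.suc (length T)) → ℕ
∣ I ∩T[ T ] i ∣ with toℕ i <ℕ? length T
... | yes p = length (filter (λ s → s <? lookup T (fromℕ< p)) I)
... | no _  = length I

Independent : ∀ {n} → (T : List (Fin n)) → List (Fin n) → Set
Independent T I = ∀ (i : Fin (ℕ.suc (length T))) → ∣ I ∩T[ T ] i ∣ ≤ toℕ i

IsBasis : ∀ {n} → (T : List (Fin n)) → List (Fin n) → Set
IsBasis T B = Independent T B ×
  (∀ (J : List _) → Sorted J → Independent T J → B ⊆ J → J ⊆ B)

_≤P_ : ∀ {n} → List (Fin n) → List (Fin n) → Set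
A ≤P [] = ⊤
[] ≤P (b ∷ B) = ⊥
(a ∷ A) ≤P (b ∷ B) = (a Fin.≤ b) × (A ≤P B)

-- For a sorted A the constraint |A ∩ T_{j-1}| ≤ j - 1 for
-- j ≤ r says that fewer than j elements of A lie below t_j, i.e. a_j ≥ t_j, and the
-- constraint for T_r = S says |A| ≤ r; together this is T ≤ A.
-- For bases: an independent B with |B| < r can be extended by one element keeping
-- T ≤ B, so a maximal B has |B| = r; conversely, if |B| = r, every sorted independent
-- J ⊇ B contains B as a sublist and has |J| ≤ r, hence equals B.
module Submission where

open import Defs
open import Data.Nat using (ℕ)
open import Data.Fin using (Fin)
open import Data.List using (List; length)
open import Data.Product using (_×_)
open import Function.Bundles using (_⇔_)
open import Relation.Binary.PropositionalEquality using (_≡_)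

open import Data.Nat using (zero; suc; z≤n; s≤s)
import Data.Nat as ℕ
import Data.Nat.Properties as ℕₚ
open import Data.Fin using (zero; suc; toℕ; fromℕ; fromℕ<; inject₁; _<_; _≤_)
open import Data.Fin.Properties
  using (_<?_; <-trans; <-irrefl; toℕ-injective; toℕ-inject₁; inject₁ℕ<; toℕ-fromℕ; toℕ-fromℕ<)
open import Data.List using ([]; _∷_; filter; lookup)
open import Data.List.Properties using (filter-accept; filter-reject)
open import Data.List.Relation.Unary.Linked as Linked using ([]; [-]; _∷_)
open import Data.List.Relation.Unary.Linked.Properties using (Linked⇒All)
open import Data.List.Relation.Unary.All as All using (All; []; _∷_)
open import Data.List.Relation.Unary.Any using (here; there)
open import Data.List.Membership.Propositional using (_∈_; _∉_)
open import Data.List.Relation.Binary.Subset.Propositional using (_⊆_)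
open import Data.List.Relation.Binary.Sublist.Propositional
  using ([]; _∷_; _∷ʳ_; minimum) renaming (_⊆_ to _⊑_)
open import Data.List.Relation.Binary.Sublist.Propositional.Properties using (length-mono-≤; to-≋)
open import Data.List.Relation.Binary.Equality.Propositional using (≋⇒≡)
open import Data.Product using (∃-syntax; _,_; proj₁; proj₂)
open import Data.Sum using (inj₁; inj₂)
open import Data.Unit using (tt)
open import Data.Empty using (⊥-elim)
open import Relation.Nullary using (¬_; yes; no; contradiction)
open import Relation.Binary.PropositionalEquality using (refl; sym; trans; cong; subst; subst₂)
open import Function.Base using (_∘_)
open import Function.Bundles using (mk⇔; Equivalence)

private
  variable
    n : ℕ
    a b s t x y : Fin n
    A B J T : List (Fin n)

head<tail : Sorted (b ∷ B) → All (b <_) B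
head<tail [-]         = []
head<tail (b<c ∷ c∷C) = Linked⇒All <-trans b<c c∷C

∷-sorted : All (b <_) B → Sorted B → Sorted (b ∷ B)
∷-sorted []          _  = [-]
∷-sorted (b<c ∷ _) sB = b<c ∷ sB

below-all⇒∉ : All (x <_) A → x ∉ A
below-all⇒∉ (x<x ∷ _)   (here refl) = <-irrefl refl x<x
below-all⇒∉ (_   ∷ x<A) (there x∈A) = below-all⇒∉ x<A x∈A

∈-∷-above : y < x → x ∈ y ∷ A → x ∈ A
∈-∷-above y<x (here refl) = ⊥-elim (<-irrefl refl y<x)
∈-∷-above _   (there x∈A) = x∈A

countBelow : Fin n → List (Fin n) → ℕ
countBelow x A = length (filter (_<? x) A)

countBelow-accept : a < x → countBelow x (a ∷ A) ≡ suc (countBelow x A)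
countBelow-accept {x = x} a<x = cong length (filter-accept (_<? x) a<x)

countBelow-reject : ¬ a < x → countBelow x (a ∷ A) ≡ countBelow x A
countBelow-reject {x = x} a≮x = cong length (filter-reject (_<? x) a≮x)

countBelow-≤all : All (x ≤_) A → countBelow x A ≡ 0
countBelow-≤all []            = refl
countBelow-≤all (x≤a ∷ x≤A) = trans (countBelow-reject (ℕₚ.≤⇒≯ x≤a)) (countBelow-≤all x≤A)

countBelow-≤head : Sorted (a ∷ A) → x ≤ a → countBelow x (a ∷ A) ≡ 0
countBelow-≤head sA x≤a =
  countBelow-≤all (x≤a ∷ All.map (λ a<y → ℕₚ.≤-trans x≤a (ℕₚ.<⇒≤ a<y)) (head<tail sA))

-- The sets T_i, i < r, are indexed by the positions of T; the constraint for
-- T_r = S is the length bound.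
Independent′ : List (Fin n) → List (Fin n) → Set
Independent′ T A = (∀ j → countBelow (lookup T j) A ℕ.≤ toℕ j) × length A ℕ.≤ length T

∩T-inject₁ : ∀ T (A : List (Fin n)) (j : Fin (length T)) → ∣ A ∩T[ T ] inject₁ j ∣ ≡ countBelow (lookup T j) A
∩T-inject₁ T A j with toℕ (inject₁ j) ℕₚ.<? length T
... | yes p = cong (λ k → countBelow (lookup T k) A)
                   (toℕ-injective (trans (toℕ-fromℕ< p) (toℕ-inject₁ j)))
... | no ¬p = contradiction (inject₁ℕ< j) ¬p

∩T-fromℕ : ∀ T (A : List (Fin n)) → ∣ A ∩T[ T ] fromℕ (length T) ∣ ≡ length A
∩T-fromℕ T A with toℕ (fromℕ (length T)) ℕₚ.<? length T
... | yes p = contradiction p (ℕₚ.<-irrefl (toℕ-fromℕ (length T)))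
... | no _  = refl

Independent⇒Independent′ : ∀ T (A : List (Fin n)) → Independent T A → Independent′ T A
Independent⇒Independent′ T A I =
  (λ j → subst₂ ℕ._≤_ (∩T-inject₁ T A j) (toℕ-inject₁ j) (I (inject₁ j))) ,
  subst₂ ℕ._≤_ (∩T-fromℕ T A) (toℕ-fromℕ (length T)) (I (fromℕ (length T)))

Independent′⇒Independent : ∀ T (A : List (Fin n)) → Independent′ T A → Independent T A
Independent′⇒Independent T A (bounded , short) i with toℕ i ℕₚ.<? length T
... | yes p = subst (countBelow (lookup T (fromℕ< p)) A ℕ.≤_) (toℕ-fromℕ< p) (bounded (fromℕ< p))
... | no ¬p = ℕₚ.≤-trans short (ℕₚ.≮⇒≥ ¬p)

-- The bound at t₁ forces t₁ ≤ a₁; the remaining bounds for (t ∷ T, a ∷ A) are those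
-- for (T, A) shifted by one, because a₁ lies below t_{j+1} exactly when it counts.
∷-Independent′⇔ : Sorted (a ∷ A) → Independent′ (t ∷ T) (a ∷ A) ⇔ (t ≤ a × Independent′ T A)
∷-Independent′⇔ {a = a} {A = A} {t = t} {T = T} sA = mk⇔ to from
  where
  to : Independent′ (t ∷ T) (a ∷ A) → t ≤ a × Independent′ T A
  to (bounded , s≤s short) = t≤a , bounded′ , short
    where
    t≤a : t ≤ a
    t≤a with a <? t
    ... | yes a<t with () ← subst (ℕ._≤ 0) (countBelow-accept a<t) (bounded zero)
    ... | no a≮t = ℕₚ.≮⇒≥ a≮t
    bounded′ : ∀ j → countBelow (lookup T j) A ℕ.≤ toℕ j
    bounded′ j with a <? lookup T j
    ... | yes a<tⱼ = ℕ.s≤s⁻¹ (subst (ℕ._≤ suc (toℕ j)) (countBelow-accept a<tⱼ) (bounded (suc j)))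
    ... | no a≮tⱼ = subst (ℕ._≤ toℕ j)
                          (trans (sym (countBelow-≤head sA (ℕₚ.≮⇒≥ a≮tⱼ))) (countBelow-reject a≮tⱼ))
                          z≤n
  from : t ≤ a × Independent′ T A → Independent′ (t ∷ T) (a ∷ A)
  from (t≤a , bounded , short) = bounded′ , s≤s short
    where
    bounded′ : ∀ j → countBelow (lookup (t ∷ T) j) (a ∷ A) ℕ.≤ toℕ j
    bounded′ zero = ℕₚ.≤-reflexive (countBelow-≤head sA t≤a)
    bounded′ (suc j) with a <? lookup T j
    ... | yes a<tⱼ = subst (ℕ._≤ suc (toℕ j)) (sym (countBelow-accept a<tⱼ)) (s≤s (bounded j))
    ... | no a≮tⱼ = subst (ℕ._≤ suc (toℕ j)) (sym (countBelow-≤head sA (ℕₚ.≮⇒≥ a≮tⱼ))) z≤n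

Independent′⇔≤P : ∀ (T : List (Fin n)) A → Sorted A → Independent′ T A ⇔ T ≤P A
Independent′⇔≤P []      []      _  = mk⇔ (λ _ → tt) (λ _ → (λ ()) , z≤n)
Independent′⇔≤P []      (a ∷ A) _  = mk⇔ (λ { (_ , ()) }) (λ ())
Independent′⇔≤P (t ∷ T) []      _  = mk⇔ (λ _ → tt) (λ _ → (λ _ → z≤n) , z≤n)
Independent′⇔≤P (t ∷ T) (a ∷ A) sA = mk⇔
  (λ I → let t≤a , I′ = to (∷-Independent′⇔ sA) I in t≤a , to ih I′)
  (λ { (t≤a , T≤A) → from (∷-Independent′⇔ sA) (t≤a , from ih T≤A) })
  where
  open Equivalence
  ih = Independent′⇔≤P T A (Linked.tail sA)

Independent⇔≤P : ∀ (T : List (Fin n)) A → Sorted A → Independent T A ⇔ T ≤P A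
Independent⇔≤P T A sA = mk⇔
  (λ I → to (Independent′⇔≤P T A sA) (Independent⇒Independent′ T A I))
  (λ T≤A → Independent′⇒Independent T A (from (Independent′⇔≤P T A sA) T≤A))
  where open Equivalence

insert : Fin n → List (Fin n) → List (Fin n)
insert s []      = s ∷ []
insert s (b ∷ B) with s <? b
... | yes _ = s ∷ b ∷ B
... | no  _ = b ∷ insert s B

insert-below : All (s <_) B → insert s B ≡ s ∷ B
insert-below [] = refl
insert-below {s = s} {B = b ∷ _} (s<b ∷ _) with s <? b
... | yes _   = refl
... | no s≮b = contradiction s<b s≮b

insert-above : b < s → insert s (b ∷ B) ≡ b ∷ insert s B
insert-above {b = b} {s = s} b<s with s <? b
... | yes s<b = contradiction b<s (ℕₚ.<⇒≯ s<b)
... | no _    = refl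

insert-All : ∀ {P : Fin n → Set} → P s → All P B → All P (insert s B)
insert-All Ps [] = Ps ∷ []
insert-All {s = s} {B = b ∷ _} Ps (Pb ∷ PB) with s <? b
... | yes _ = Ps ∷ Pb ∷ PB
... | no  _ = Pb ∷ insert-All Ps PB

∈-insert : ∀ s (B : List (Fin n)) → s ∈ insert s B
∈-insert s [] = here refl
∈-insert s (b ∷ B) with s <? b
... | yes _ = here refl
... | no  _ = there (∈-insert s B)

⊆-insert : ∀ s (B : List (Fin n)) → B ⊆ insert s B
⊆-insert s (b ∷ B) x∈b∷B with s <? b
... | yes _ = there x∈b∷B
⊆-insert s (b ∷ B) (here x≡b)  | no _ = here x≡b
⊆-insert s (b ∷ B) (there x∈B) | no _ = there (⊆-insert s B x∈B)

insert-sorted : Sorted B → s ∉ B → Sorted (insert s B)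
insert-sorted {B = []} _ _ = [-]
insert-sorted {B = b ∷ B} {s = s} sB s∉b∷B with s <? b
... | yes s<b = s<b ∷ sB
... | no s≮b = ∷-sorted (insert-All b<s (head<tail sB)) (insert-sorted (Linked.tail sB) (s∉b∷B ∘ there))
  where
  b<s : b < s
  b<s = ℕₚ.≤∧≢⇒< (ℕₚ.≮⇒≥ s≮b) (λ b≡s → s∉b∷B (here (sym (toℕ-injective b≡s))))

-- The new element is t_j for the largest j with j = 1 or t_j > b_{j-1}.
augment : Sorted T → Sorted B → T ≤P B → length B ℕ.< length T → ∃[ s ] s ∉ B × T ≤P insert s B
augment {T = t ∷ _}  {B = []}    _ _ _ _ = t , (λ ()) , ℕₚ.≤-refl , tt
augment {T = _ ∷ []} {B = _ ∷ _} _ _ _ (s≤s ())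
augment {T = t ∷ t′ ∷ T} {B = b ∷ B} sT sB (t≤b , T≤B) (s≤s |B|<|T|)
  with augment (Linked.tail sT) (Linked.tail sB) T≤B |B|<|T|
... | s , s∉B , T≤B+s with b <? s
...   | yes b<s = s , s∉b∷B , subst ((t ∷ t′ ∷ T) ≤P_) (sym (insert-above b<s)) (t≤b , T≤B+s)
  where
  s∉b∷B : s ∉ b ∷ B
  s∉b∷B (here s≡b)  = <-irrefl (sym s≡b) b<s
  s∉b∷B (there s∈B) = s∉B s∈B
...   | no b≮s = t , below-all⇒∉ t<b∷B ,
                 subst ((t ∷ t′ ∷ T) ≤P_) (sym (insert-below t<b∷B))
                       (ℕₚ.≤-refl , ℕₚ.≤-trans t′≤s s≤b , proj₂ T≤s∷B)
  where
  s≤b : s ≤ b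
  s≤b = ℕₚ.≮⇒≥ b≮s
  T≤s∷B : (t′ ∷ T) ≤P (s ∷ B)
  T≤s∷B = subst ((t′ ∷ T) ≤P_)
                (insert-below (All.map (ℕₚ.≤-<-trans s≤b) (head<tail sB)))
                T≤B+s
  t′≤s : t′ ≤ s
  t′≤s = proj₁ T≤s∷B
  t<b : t < b
  t<b = ℕₚ.<-≤-trans (Linked.head sT) (ℕₚ.≤-trans t′≤s s≤b)
  t<b∷B : All (t <_) (b ∷ B)
  t<b∷B = t<b ∷ All.map (<-trans t<b) (head<tail sB)

sorted-⊆⇒⊑ : Sorted B → Sorted J → B ⊆ J → B ⊑ J
sorted-⊆⇒⊑ {B = []} _ _ _ = minimum _
sorted-⊆⇒⊑ {B = b ∷ B} {J = []} _ _ b∷B⊆[] with () ← b∷B⊆[] (here refl)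
sorted-⊆⇒⊑ {B = b ∷ B} {J = j ∷ J} sB sJ b∷B⊆j∷J with b∷B⊆j∷J (here refl)
... | here refl = refl ∷ sorted-⊆⇒⊑ (Linked.tail sB) (Linked.tail sJ)
                    (λ x∈B → ∈-∷-above (All.lookup (head<tail sB) x∈B) (b∷B⊆j∷J (there x∈B)))
... | there b∈J = j ∷ʳ sorted-⊆⇒⊑ sB (Linked.tail sJ) (λ x∈b∷B → ∈-∷-above (j< x∈b∷B) (b∷B⊆j∷J x∈b∷B))
  where
  j<b : j < b
  j<b = All.lookup (head<tail sJ) b∈J
  j< : x ∈ b ∷ B → j < x
  j< (here refl)  = j<b
  j< (there x∈B) = <-trans j<b (All.lookup (head<tail sB) x∈B)

sorted-⊆∧length⇒≡ : Sorted B → Sorted J → B ⊆ J → length J ℕ.≤ length B → B ≡ J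
sorted-⊆∧length⇒≡ sB sJ B⊆J |J|≤|B| = ≋⇒≡ (to-≋ (ℕₚ.≤-antisym (length-mono-≤ B⊑J) |J|≤|B|) B⊑J)
  where
  B⊑J = sorted-⊆⇒⊑ sB sJ B⊆J

IsBasis⇔length≡∧≤P : Sorted T → Sorted B → IsBasis T B ⇔ (length B ≡ length T × T ≤P B)
IsBasis⇔length≡∧≤P {T = T} {B = B} sT sB = mk⇔ to from
  where
  independent⇔ : ∀ {A} → Sorted A → Independent T A ⇔ T ≤P A
  independent⇔ = Independent⇔≤P T _

  short : ∀ {A} → Independent T A → length A ℕ.≤ length T
  short = proj₂ ∘ Independent⇒Independent′ T _

  to : IsBasis T B → length B ≡ length T × T ≤P B
  to (indB , maximal) = |B|≡|T| , T≤B
    where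
    T≤B = Equivalence.to (independent⇔ sB) indB
    |B|≡|T| : length B ≡ length T
    |B|≡|T| with ℕₚ.m≤n⇒m<n∨m≡n (short indB)
    ... | inj₂ |B|≡|T| = |B|≡|T|
    ... | inj₁ |B|<|T| with s , s∉B , T≤B+s ← augment sT sB T≤B |B|<|T| =
      contradiction (maximal (insert s B) sB+s indB+s (⊆-insert s B) (∈-insert s B)) s∉B
      where
      sB+s = insert-sorted sB s∉B
      indB+s = Equivalence.from (independent⇔ sB+s) T≤B+s

  from : length B ≡ length T × T ≤P B → IsBasis T B
  from (|B|≡|T| , T≤B) = Equivalence.from (independent⇔ sB) T≤B , maximal
    where
    maximal : ∀ J → Sorted J → Independent T J → B ⊆ J → J ⊆ B
    maximal J sJ indJ B⊆J =
      subst (J ⊆_) (sym (sorted-⊆∧length⇒≡ sB sJ B⊆J (subst (length J ℕ.≤_) (sym |B|≡|T|) (short indJ))))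
            (λ x∈J → x∈J)

proposition6p1 : (n : ℕ) (T : List (Fin n)) → Sorted T →
    ((A : List (Fin n)) → Sorted A → (Independent T A ⇔ T ≤P A)) ×
    ((B : List (Fin n)) → Sorted B → (IsBasis T B ⇔ (length B ≡ length T × T ≤P B)))
proposition6p1 n T sT = Independent⇔≤P T , λ B → IsBasis⇔length≡∧≤P sT
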